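{- Let $G$ be a finite simple undirected graph, let $S\subseteq V(G)$ be an odd cycle transversal of $G$, and let $T\subseteq S$ be such that $G[T]$ is bipartite. Let $H=G[V(G)\setminus(S\setminus T)]$, let $h=|V(H)|$, and let $B=V(H)\setminus T$. Then for every non-negative integer $r$: $H$ has an odd cycle transversal $T'\subseteq B$ with $|T'|=r$ if and only if $H^2$ has a vertex cover $X$ with $|X|=h+r$ such that for each $v\in T$, exactly one of $v_1, v_2$ belongs to $X$.
   Context: An odd cycle transversal (OCT) of a graph $G$ is a set $S\subseteq V(G)$ such that $G-S$ is bipartite. A vertex cover of a graph is a set of vertices meeting every edge. For a graph $H$, the graph $H^2$ has vertex set $V_1\cup V_2$, where $V_i=\{v_i \mid v\in V(H)\}$ for $i\in\{1,2\}$ are two disjoint copies of $V(H)$, and edge set $\{\{u_1,v_1\},\{u_2,v_2\}\mid \{u,v\}\in E(H)\}\cup\{\{v_1,v_2\}\mid v\in V(H)\}$. (Here $H^2$ is not the graph square.) -}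

module Defs where

open import Data.Nat using (ℕ; _+_)
open import Data.Bool using (Bool)
open import Data.Fin using (Fin; splitAt; _↑ˡ_; _↑ʳ_)
open import Data.Fin.Subset using (Subset; _∈_; _∉_; _⊆_; _─_; ⊤)
open import Data.Sum using (_⊎_; inj₁; inj₂)
open import Data.Product using (Σ; _×_)
open import Relation.Binary.PropositionalEquality using (_≡_; _≢_)
import Relation.Binary.PropositionalEquality as Eq
open import Relation.Nullary using (¬_)

record Graph (n : ℕ) : Set₁ where
  field
    Adj    : Fin n → Fin n → Set
    adj-sym    : ∀ {u v} → Adj u v → Adj v u
    adj-irrefl : ∀ {v} → ¬ Adj v v
open Graph public

IsBipartiteOn : ∀ {n} → Graph n → Subset n → Set
IsBipartiteOn {n} G U =
  Σ (Fin n → Bool) λ c → ∀ u v → u ∈ U → v ∈ U → Adj G u v → c u ≢ c v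

IsOCTOn : ∀ {n} → Graph n → Subset n → Subset n → Set
IsOCTOn G U S = S ⊆ U × IsBipartiteOn G (U ─ S)

IsOCT : ∀ {n} → Graph n → Subset n → Set
IsOCT G S = IsOCTOn G ⊤ S

IsVertexCoverOn : ∀ {n} → Graph n → Subset n → Subset n → Set
IsVertexCoverOn G U X =
  X ⊆ U × (∀ u v → u ∈ U → v ∈ U → Adj G u v → u ∈ X ⊎ v ∈ X)

-- The "doubled" graph on Fin (n + n): v₁ = v ↑ˡ n, v₂ = n ↑ʳ v.
-- For H = G[W], H² is the induced subgraph of Double G on W₁ ∪ W₂ (= W ++ W).
module _ {n : ℕ} (G : Graph n) where
  private
    AdjS : Fin n ⊎ Fin n → Fin n ⊎ Fin n → Set
    AdjS (inj₁ u) (inj₁ v) = Adj G u v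
    AdjS (inj₂ u) (inj₂ v) = Adj G u v
    AdjS (inj₁ u) (inj₂ v) = u ≡ v
    AdjS (inj₂ u) (inj₁ v) = u ≡ v

    symS : ∀ x y → AdjS x y → AdjS y x
    symS (inj₁ u) (inj₁ v) e = adj-sym G e
    symS (inj₂ u) (inj₂ v) e = adj-sym G e
    symS (inj₁ u) (inj₂ v) e = Eq.sym e
    symS (inj₂ u) (inj₁ v) e = Eq.sym e

    irrS : ∀ x → ¬ AdjS x x
    irrS (inj₁ u) = adj-irrefl G
    irrS (inj₂ u) = adj-irrefl G

  Double : Graph (n + n)
  Double = record
    { Adj    = λ x y → AdjS (splitAt n x) (splitAt n y)
    ; adj-sym    = λ {x} {y} → symS (splitAt n x) (splitAt n y)
    ; adj-irrefl = λ {x} → irrS (splitAt n x)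
    }

ExactlyOne : Set → Set → Set
ExactlyOne P Q = (P × ¬ Q) ⊎ (¬ P × Q)

module Submission where

-- Write W = ∁ (S ─ T) for the vertex set of H.  The theorem is a
-- correspondence between odd cycle transversals T′ of H and vertex covers of H²,
-- and it holds for every W and every T ⊆ W:
--
--  * A vertex cover of H² = Double G restricted to W ++ W is exactly a pair
--    (X₁, X₂) of vertex covers of G[W] whose union is W (the rungs v₁v₂).
--  * If T′ ⊆ W and G[W ─ T′] has colour classes C, ∁ C, then C and ∁ C both
--    cover G[W ─ T′], and X₁ = W ∩ (T′ ∪ C), X₂ = W ∩ (T′ ∪ ∁ C) is such a
--    pair with X₁ ∩ X₂ = T′.
--  * Conversely, for such a pair, X₁ and ∁ X₁ both cover G[W ─ (X₁ ∩ X₂)], so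
--    X₁ ∩ X₂ is an odd cycle transversal of G[W].
--  * Sizes match by inclusion–exclusion: |X₁| + |X₂| = |X₁ ∪ X₂| + |X₁ ∩ X₂|.
--  * Vertices v ∈ T lie in W but not in T′, and these are exactly the vertices
--    for which exactly one of v₁, v₂ is in the cover.

open import Defs
open import Data.Nat using (ℕ; _+_; suc)
open import Data.Nat.Properties using (+-suc; +-cancelˡ-≡)
open import Data.Bool using (true; false; not)
open import Data.Bool.Properties using (not-injective)
open import Data.Fin using (Fin; _↑ˡ_; _↑ʳ_; zero; suc; splitAt)
open import Data.Fin.Properties using (splitAt-↑ˡ; splitAt-↑ʳ; splitAt⁻¹-↑ˡ; splitAt⁻¹-↑ʳ)
open import Data.Fin.Subset using (Subset; _∈_; _∉_; _⊆_; _─_; ∁; ∣_∣; _∩_; _∪_)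
open import Data.Fin.Subset.Properties
  using (_∈?_; ⊆-antisym; x∈p∩q⁺; x∈p∩q⁻; p∩q⊆p; x∈p∪q⁺; x∈p∪q⁻; p⊆p∪q; q⊆p∪q;
         x∈∁p⇒x∉p; x∉p⇒x∈∁p; x∈p∧x∉q⇒x∈p─q; p─q⊆p)
open import Data.Vec using ([]; _∷_; _++_; lookup; tabulate)
import Data.Vec as Vec
open import Data.Vec.Base using (here; there)
open import Data.Vec.Properties using ([]=⇒lookup; lookup⇒[]=; lookup∘tabulate; tabulate-∘)
open import Data.Product using (Σ; _×_; _,_; proj₁; proj₂)
open import Data.Sum using (_⊎_; inj₁; inj₂; [_,_]′) renaming (map to map⊎; swap to swap⊎)
open import Data.Empty using (⊥-elim)
open import Relation.Nullary using (¬_; yes; no)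
open import Relation.Binary.PropositionalEquality
  using (_≡_; _≢_; refl; sym; trans; cong; subst; module ≡-Reasoning)
open import Function using (_∘_)
open import Function.Bundles using (_⇔_; mk⇔; Equivalence)
open import Function.Construct.Symmetry using (⇔-sym)

private
  variable
    m n : ℕ

x∈p─q⇒x∉q : ∀ {x : Fin n} (p q : Subset n) → x ∈ p ─ q → x ∉ q
x∈p─q⇒x∉q (_ ∷ p) (true ∷ q) () here
x∈p─q⇒x∉q (_ ∷ p) (false ∷ q) here ()
x∈p─q⇒x∉q (_ ∷ p) (_ ∷ q) (there x∈p─q) (there x∈q) = x∈p─q⇒x∉q p q x∈p─q x∈q

q⊆∁[p─q] : (p q : Subset n) → q ⊆ ∁ (p ─ q)
q⊆∁[p─q] p q x∈q = x∉p⇒x∈∁p (λ x∈p─q → x∈p─q⇒x∉q p q x∈p─q x∈q)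

∈-++⁺ˡ : {p : Subset m} {q : Subset n} {i : Fin m} → i ∈ p → (i ↑ˡ n) ∈ (p ++ q)
∈-++⁺ˡ here = here
∈-++⁺ˡ (there i∈p) = there (∈-++⁺ˡ i∈p)

∈-++⁻ˡ : (p : Subset m) {q : Subset n} {i : Fin m} → (i ↑ˡ n) ∈ (p ++ q) → i ∈ p
∈-++⁻ˡ (_ ∷ p) {i = zero} here = here
∈-++⁻ˡ (_ ∷ p) {i = suc i} (there i∈p++q) = there (∈-++⁻ˡ p i∈p++q)

∈-++⁺ʳ : (p : Subset m) {q : Subset n} {i : Fin n} → i ∈ q → (m ↑ʳ i) ∈ (p ++ q)
∈-++⁺ʳ [] i∈q = i∈q
∈-++⁺ʳ (_ ∷ p) i∈q = there (∈-++⁺ʳ p i∈q)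

∈-++⁻ʳ : (p : Subset m) {q : Subset n} {i : Fin n} → (m ↑ʳ i) ∈ (p ++ q) → i ∈ q
∈-++⁻ʳ [] i∈q = i∈q
∈-++⁻ʳ (_ ∷ p) (there i∈p++q) = ∈-++⁻ʳ p i∈p++q

∈-++ˡ : (p : Subset m) {q : Subset n} {i : Fin m} → (i ↑ˡ n) ∈ (p ++ q) ⇔ i ∈ p
∈-++ˡ p = mk⇔ (∈-++⁻ˡ p) ∈-++⁺ˡ

∈-++ʳ : (p : Subset m) {q : Subset n} {i : Fin n} → (m ↑ʳ i) ∈ (p ++ q) ⇔ i ∈ q
∈-++ʳ p = mk⇔ (∈-++⁻ʳ p) (∈-++⁺ʳ p)

∣p++q∣ : (p : Subset m) (q : Subset n) → ∣ p ++ q ∣ ≡ ∣ p ∣ + ∣ q ∣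
∣p++q∣ [] q = refl
∣p++q∣ (true ∷ p) q = cong suc (∣p++q∣ p q)
∣p++q∣ (false ∷ p) q = ∣p++q∣ p q

∣p∣+∣q∣≡∣p∪q∣+∣p∩q∣ : (p q : Subset n) → ∣ p ∣ + ∣ q ∣ ≡ ∣ p ∪ q ∣ + ∣ p ∩ q ∣
∣p∣+∣q∣≡∣p∪q∣+∣p∩q∣ [] [] = refl
∣p∣+∣q∣≡∣p∪q∣+∣p∩q∣ (true ∷ p) (true ∷ q) = cong suc (begin
  ∣ p ∣ + suc ∣ q ∣               ≡⟨ +-suc ∣ p ∣ ∣ q ∣ ⟩
  suc (∣ p ∣ + ∣ q ∣)             ≡⟨ cong suc (∣p∣+∣q∣≡∣p∪q∣+∣p∩q∣ p q) ⟩
  suc (∣ p ∪ q ∣ + ∣ p ∩ q ∣)     ≡⟨ +-suc ∣ p ∪ q ∣ ∣ p ∩ q ∣ ⟨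
  ∣ p ∪ q ∣ + suc ∣ p ∩ q ∣       ∎)
  where open ≡-Reasoning
∣p∣+∣q∣≡∣p∪q∣+∣p∩q∣ (true ∷ p) (false ∷ q) = cong suc (∣p∣+∣q∣≡∣p∪q∣+∣p∩q∣ p q)
∣p∣+∣q∣≡∣p∪q∣+∣p∩q∣ (false ∷ p) (true ∷ q) =
  trans (+-suc ∣ p ∣ ∣ q ∣) (cong suc (∣p∣+∣q∣≡∣p∪q∣+∣p∩q∣ p q))
∣p∣+∣q∣≡∣p∪q∣+∣p∩q∣ (false ∷ p) (false ∷ q) = ∣p∣+∣q∣≡∣p∪q∣+∣p∩q∣ p q

ExactlyOne-map : {P P′ Q Q′ : Set} → P ⇔ P′ → Q ⇔ Q′ → ExactlyOne P Q → ExactlyOne P′ Q′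
ExactlyOne-map P⇔P′ Q⇔Q′ (inj₁ (p , ¬q)) =
  inj₁ (Equivalence.to P⇔P′ p , ¬q ∘ Equivalence.from Q⇔Q′)
ExactlyOne-map P⇔P′ Q⇔Q′ (inj₂ (¬p , q)) =
  inj₂ (¬p ∘ Equivalence.from P⇔P′ , Equivalence.to Q⇔Q′ q)

ExactlyOne⇒¬both : {P Q : Set} → ExactlyOne P Q → ¬ (P × Q)
ExactlyOne⇒¬both (inj₁ (_ , ¬q)) (_ , q) = ¬q q
ExactlyOne⇒¬both (inj₂ (¬p , _)) (p , _) = ¬p p

Covers : Graph n → Subset n → Subset n → Set
Covers G U X = ∀ u v → u ∈ U → v ∈ U → Adj G u v → u ∈ X ⊎ v ∈ X

Covers-mono : ∀ (G : Graph n) {U V X} → V ⊆ U → Covers G U X → Covers G V X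
Covers-mono G V⊆U cov u v u∈V v∈V = cov u v (V⊆U u∈V) (V⊆U v∈V)

trueClass-covers : ∀ (G : Graph n) U ((c , proper) : IsBipartiteOn G U) → Covers G U (tabulate c)
trueClass-covers G U (c , proper) u v u∈U v∈U uv with c u in cu | c v in cv
... | true  | _     = inj₁ (lookup⇒[]= u (tabulate c) (trans (lookup∘tabulate c u) cu))
... | false | true  = inj₂ (lookup⇒[]= v (tabulate c) (trans (lookup∘tabulate c v) cv))
... | false | false = ⊥-elim (proper u v u∈U v∈U uv (trans cu (sym cv)))

bipartite⇒complementaryCovers : ∀ (G : Graph n) U → IsBipartiteOn G U →
  Σ (Subset n) λ C → Covers G U C × Covers G U (∁ C)
bipartite⇒complementaryCovers G U (c , proper) =
  tabulate c , trueClass-covers G U (c , proper) , ∁C-covers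
  where
  -- not ∘ c is again a proper colouring, and its true class is ∁ C.
  ∁C-covers : Covers G U (∁ (tabulate c))
  ∁C-covers = subst (Covers G U) (tabulate-∘ not c)
    (trueClass-covers G U (not ∘ c , λ u v u∈U v∈U uv → proper u v u∈U v∈U uv ∘ not-injective))

complementaryCovers⇒bipartite : ∀ (G : Graph n) U C →
  Covers G U C → Covers G U (∁ C) → IsBipartiteOn G U
complementaryCovers⇒bipartite G U C cov cov∁ = lookup C , proper
  where
  sameColour : ∀ {x y} → lookup C x ≡ lookup C y → x ∈ C → y ∈ C
  sameColour {y = y} same x∈C = lookup⇒[]= y C (trans (sym same) ([]=⇒lookup x∈C))

  proper : ∀ u v → u ∈ U → v ∈ U → Adj G u v → lookup C u ≢ lookup C v
  proper u v u∈U v∈U uv same with cov u v u∈U v∈U uv | cov∁ u v u∈U v∈U uv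
  ... | inj₁ u∈C | inj₁ u∈∁C = x∈∁p⇒x∉p u∈∁C u∈C
  ... | inj₁ u∈C | inj₂ v∈∁C = x∈∁p⇒x∉p v∈∁C (sameColour same u∈C)
  ... | inj₂ v∈C | inj₁ u∈∁C = x∈∁p⇒x∉p u∈∁C (sameColour (sym same) v∈C)
  ... | inj₂ v∈C | inj₂ v∈∁C = x∈∁p⇒x∉p v∈∁C v∈C

data Copy (n : ℕ) : Fin (n + n) → Set where
  first  : (v : Fin n) → Copy n (v ↑ˡ n)
  second : (v : Fin n) → Copy n (n ↑ʳ v)

copy : ∀ n (x : Fin (n + n)) → Copy n x
copy n x with splitAt n x in eq
... | inj₁ v = subst (Copy n) (splitAt⁻¹-↑ˡ eq) (first v)
... | inj₂ v = subst (Copy n) (splitAt⁻¹-↑ʳ eq) (second v)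

module _ (G : Graph n) where

  adj₁⁻ : ∀ {u v} → Adj (Double G) (u ↑ˡ n) (v ↑ˡ n) → Adj G u v
  adj₁⁻ {u} {v} uv rewrite splitAt-↑ˡ n u n | splitAt-↑ˡ n v n = uv

  adj₂⁻ : ∀ {u v} → Adj (Double G) (n ↑ʳ u) (n ↑ʳ v) → Adj G u v
  adj₂⁻ {u} {v} uv rewrite splitAt-↑ʳ n n u | splitAt-↑ʳ n n v = uv

  rung⁻ : ∀ {u v} → Adj (Double G) (u ↑ˡ n) (n ↑ʳ v) → u ≡ v
  rung⁻ {u} {v} uv rewrite splitAt-↑ˡ n u n | splitAt-↑ʳ n n v = uv

  adj₁⁺ : ∀ {u v} → Adj G u v → Adj (Double G) (u ↑ˡ n) (v ↑ˡ n)
  adj₁⁺ {u} {v} uv rewrite splitAt-↑ˡ n u n | splitAt-↑ˡ n v n = uv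

  adj₂⁺ : ∀ {u v} → Adj G u v → Adj (Double G) (n ↑ʳ u) (n ↑ʳ v)
  adj₂⁺ {u} {v} uv rewrite splitAt-↑ʳ n n u | splitAt-↑ʳ n n v = uv

  rung⁺ : ∀ v → Adj (Double G) (v ↑ˡ n) (n ↑ʳ v)
  rung⁺ v rewrite splitAt-↑ˡ n v n | splitAt-↑ʳ n n v = refl

PairCover : Graph n → Subset n → Subset n → Subset n → Set
PairCover G W X₁ X₂ = IsVertexCoverOn G W X₁ × IsVertexCoverOn G W X₂ × W ⊆ X₁ ∪ X₂

-- The vertex covers of (Double G)[W ++ W] are exactly the pair covers of G[W]:
-- its edges are the edges of both copies of G[W] together with the rungs v₁v₂.
pairCover⇒doubledCover : ∀ (G : Graph n) W X₁ X₂ →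
  PairCover G W X₁ X₂ → IsVertexCoverOn (Double G) (W ++ W) (X₁ ++ X₂)
pairCover⇒doubledCover {n} G W X₁ X₂ ((X₁⊆W , cov₁) , (X₂⊆W , cov₂) , W⊆X₁∪X₂) =
  X⊆W++W , cover
  where
  X⊆W++W : X₁ ++ X₂ ⊆ W ++ W
  X⊆W++W {x} x∈X with copy n x
  ... | first v  = ∈-++⁺ˡ (X₁⊆W (∈-++⁻ˡ X₁ x∈X))
  ... | second v = ∈-++⁺ʳ W (X₂⊆W (∈-++⁻ʳ X₁ x∈X))

  cover : Covers (Double G) (W ++ W) (X₁ ++ X₂)
  cover x y x∈W y∈W xy with copy n x | copy n y
  ... | first u | first v =
    map⊎ ∈-++⁺ˡ ∈-++⁺ˡ (cov₁ u v (∈-++⁻ˡ W x∈W) (∈-++⁻ˡ W y∈W) (adj₁⁻ G xy))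
  ... | second u | second v =
    map⊎ (∈-++⁺ʳ X₁) (∈-++⁺ʳ X₁) (cov₂ u v (∈-++⁻ʳ W x∈W) (∈-++⁻ʳ W y∈W) (adj₂⁻ G xy))
  ... | first u | second v with refl ← rung⁻ G xy =
    map⊎ ∈-++⁺ˡ (∈-++⁺ʳ X₁) (x∈p∪q⁻ X₁ X₂ (W⊆X₁∪X₂ (∈-++⁻ˡ W x∈W)))
  ... | second u | first v with refl ← rung⁻ G (adj-sym (Double G) xy) =
    map⊎ (∈-++⁺ʳ X₁) ∈-++⁺ˡ (swap⊎ (x∈p∪q⁻ X₁ X₂ (W⊆X₁∪X₂ (∈-++⁻ʳ W x∈W))))

doubledCover⇒pairCover : ∀ (G : Graph n) W X₁ X₂ →
  IsVertexCoverOn (Double G) (W ++ W) (X₁ ++ X₂) → PairCover G W X₁ X₂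
doubledCover⇒pairCover {n} G W X₁ X₂ (X⊆W++W , cover) =
  (X₁⊆W , cov₁) , (X₂⊆W , cov₂) , W⊆X₁∪X₂
  where
  X₁⊆W : X₁ ⊆ W
  X₁⊆W = ∈-++⁻ˡ W ∘ X⊆W++W ∘ ∈-++⁺ˡ

  X₂⊆W : X₂ ⊆ W
  X₂⊆W = ∈-++⁻ʳ W ∘ X⊆W++W ∘ ∈-++⁺ʳ X₁

  cov₁ : Covers G W X₁
  cov₁ u v u∈W v∈W uv =
    map⊎ (∈-++⁻ˡ X₁) (∈-++⁻ˡ X₁) (cover _ _ (∈-++⁺ˡ u∈W) (∈-++⁺ˡ v∈W) (adj₁⁺ G uv))

  cov₂ : Covers G W X₂
  cov₂ u v u∈W v∈W uv =
    map⊎ (∈-++⁻ʳ X₁) (∈-++⁻ʳ X₁) (cover _ _ (∈-++⁺ʳ W u∈W) (∈-++⁺ʳ W v∈W) (adj₂⁺ G uv))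

  W⊆X₁∪X₂ : W ⊆ X₁ ∪ X₂
  W⊆X₁∪X₂ {v} v∈W = x∈p∪q⁺
    (map⊎ (∈-++⁻ˡ X₁) (∈-++⁻ʳ X₁) (cover _ _ (∈-++⁺ˡ v∈W) (∈-++⁺ʳ W v∈W) (rung⁺ G v)))

-- Put the removed vertices T′ back into a cover C of G[W ─ T′].
raise : Subset n → Subset n → Subset n → Subset n
raise W T′ C = W ∩ (T′ ∪ C)

raise⁺ : ∀ {W T′ C : Subset n} {v} → v ∈ W → v ∈ C → v ∈ raise W T′ C
raise⁺ {T′ = T′} v∈W v∈C = x∈p∩q⁺ (v∈W , q⊆p∪q T′ _ v∈C)

raise⁻ : ∀ {W T′ C : Subset n} {v} → v ∉ T′ → v ∈ raise W T′ C → v ∈ C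
raise⁻ {W = W} {T′} {C} v∉T′ v∈raise with x∈p∪q⁻ T′ C (proj₂ (x∈p∩q⁻ W _ v∈raise))
... | inj₁ v∈T′ = ⊥-elim (v∉T′ v∈T′)
... | inj₂ v∈C = v∈C

raise-isVertexCover : ∀ (G : Graph n) W T′ C →
  Covers G (W ─ T′) C → IsVertexCoverOn G W (raise W T′ C)
raise-isVertexCover G W T′ C cov = p∩q⊆p W _ , cover
  where
  cover : Covers G W (raise W T′ C)
  cover u v u∈W v∈W uv with u ∈? T′ | v ∈? T′
  ... | yes u∈T′ | _ = inj₁ (x∈p∩q⁺ (u∈W , p⊆p∪q C u∈T′))
  ... | no _ | yes v∈T′ = inj₂ (x∈p∩q⁺ (v∈W , p⊆p∪q C v∈T′))
  ... | no u∉T′ | no v∉T′ =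
    map⊎ (raise⁺ u∈W) (raise⁺ v∈W)
      (cov u v (x∈p∧x∉q⇒x∈p─q u∈W u∉T′) (x∈p∧x∉q⇒x∈p─q v∈W v∉T′) uv)

module _ (G : Graph n) (W T′ C : Subset n) where

  raise-pairCover : Covers G (W ─ T′) C → Covers G (W ─ T′) (∁ C) →
    PairCover G W (raise W T′ C) (raise W T′ (∁ C))
  raise-pairCover cov cov∁ =
    raise-isVertexCover G W T′ C cov , raise-isVertexCover G W T′ (∁ C) cov∁ , W⊆∪
    where
    W⊆∪ : W ⊆ raise W T′ C ∪ raise W T′ (∁ C)
    W⊆∪ {v} v∈W with v ∈? C
    ... | yes v∈C = x∈p∪q⁺ (inj₁ (raise⁺ v∈W v∈C))
    ... | no v∉C = x∈p∪q⁺ (inj₂ (raise⁺ v∈W (x∉p⇒x∈∁p v∉C)))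

  raise-∩ : T′ ⊆ W → raise W T′ C ∩ raise W T′ (∁ C) ≡ T′
  raise-∩ T′⊆W = ⊆-antisym ∩⊆T′ T′⊆∩
    where
    ∩⊆T′ : raise W T′ C ∩ raise W T′ (∁ C) ⊆ T′
    ∩⊆T′ {v} v∈∩ with v ∈? T′
    ... | yes v∈T′ = v∈T′
    ... | no v∉T′ =
      let v∈₁ , v∈₂ = x∈p∩q⁻ (raise W T′ C) _ v∈∩
      in ⊥-elim (x∈∁p⇒x∉p (raise⁻ v∉T′ v∈₂) (raise⁻ v∉T′ v∈₁))
    T′⊆∩ : T′ ⊆ raise W T′ C ∩ raise W T′ (∁ C)
    T′⊆∩ v∈T′ =
      x∈p∩q⁺ (x∈p∩q⁺ (T′⊆W v∈T′ , p⊆p∪q C v∈T′) , x∈p∩q⁺ (T′⊆W v∈T′ , p⊆p∪q (∁ C) v∈T′))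

  raise-exactlyOne : ∀ {v} → v ∈ W → v ∉ T′ →
    ExactlyOne (v ∈ raise W T′ C) (v ∈ raise W T′ (∁ C))
  raise-exactlyOne {v} v∈W v∉T′ with v ∈? C
  ... | yes v∈C = inj₁ (raise⁺ v∈W v∈C , λ v∈₂ → x∈∁p⇒x∉p (raise⁻ v∉T′ v∈₂) v∈C)
  ... | no v∉C = inj₂ (v∉C ∘ raise⁻ v∉T′ , raise⁺ v∈W (x∉p⇒x∈∁p v∉C))

module _ (G : Graph n) (W X₁ X₂ : Subset n) where

  -- The overlap X₁ ∩ X₂ of a pair cover is an odd cycle transversal of G[W]:
  -- X₁ and its complement both cover G[W ─ (X₁ ∩ X₂)].
  pairCover⇒OCT : PairCover G W X₁ X₂ → IsOCTOn G W (X₁ ∩ X₂)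
  pairCover⇒OCT ((X₁⊆W , cov₁) , (_ , cov₂) , _) =
    X₁⊆W ∘ p∩q⊆p X₁ X₂ ,
    complementaryCovers⇒bipartite G (W ─ X₁ ∩ X₂) X₁ (Covers-mono G (p─q⊆p W _) cov₁) cov∁
    where
    outsideX₁ : ∀ {v} → v ∉ X₁ ∩ X₂ → v ∈ X₂ → v ∈ ∁ X₁
    outsideX₁ v∉∩ v∈X₂ = x∉p⇒x∈∁p (λ v∈X₁ → v∉∩ (x∈p∩q⁺ (v∈X₁ , v∈X₂)))

    cov∁ : Covers G (W ─ X₁ ∩ X₂) (∁ X₁)
    cov∁ u v u∈ v∈ uv =
      map⊎ (outsideX₁ (x∈p─q⇒x∉q W _ u∈)) (outsideX₁ (x∈p─q⇒x∉q W _ v∈))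
        (cov₂ u v (p─q⊆p W _ u∈) (p─q⊆p W _ v∈) uv)

  pairCover-size : PairCover G W X₁ X₂ → ∣ X₁ ∣ + ∣ X₂ ∣ ≡ ∣ W ∣ + ∣ X₁ ∩ X₂ ∣
  pairCover-size ((X₁⊆W , _) , (X₂⊆W , _) , W⊆X₁∪X₂) =
    trans (∣p∣+∣q∣≡∣p∪q∣+∣p∩q∣ X₁ X₂) (cong (λ U → ∣ U ∣ + ∣ X₁ ∩ X₂ ∣) X₁∪X₂≡W)
    where
    X₁∪X₂≡W : X₁ ∪ X₂ ≡ W
    X₁∪X₂≡W = ⊆-antisym ([ X₁⊆W , X₂⊆W ]′ ∘ x∈p∪q⁻ X₁ X₂) W⊆X₁∪X₂

Transversal : Graph n → Subset n → Subset n → ℕ → Set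
Transversal {n} G W T r = Σ (Subset n) λ T′ → T′ ⊆ W ─ T × IsOCTOn G W T′ × ∣ T′ ∣ ≡ r

DoubledCover : Graph n → Subset n → Subset n → ℕ → Set
DoubledCover {n} G W T r = Σ (Subset (n + n)) λ X →
  IsVertexCoverOn (Double G) (W ++ W) X
  × ∣ X ∣ ≡ ∣ W ∣ + r
  × (∀ v → v ∈ T → ExactlyOne ((v ↑ˡ n) ∈ X) ((n ↑ʳ v) ∈ X))

-- From a transversal T′ with colour classes C, ∁ C of G[W ─ T′], the vertex
-- cover is (W ∩ (T′ ∪ C)) ++ (W ∩ (T′ ∪ ∁ C)); T ⊆ W ─ T′ is split by it.
transversal⇒doubledCover : ∀ (G : Graph n) W T r → T ⊆ W →
  Transversal G W T r → DoubledCover G W T r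
transversal⇒doubledCover {n} G W T r T⊆W (T′ , T′⊆W─T , (T′⊆W , bipartite) , ∣T′∣≡r)
  with C , cov , cov∁ ← bipartite⇒complementaryCovers G (W ─ T′) bipartite =
  X₁ ++ X₂ , pairCover⇒doubledCover G W X₁ X₂ pair , size , exactlyOne
  where
  X₁ X₂ : Subset n
  X₁ = raise W T′ C
  X₂ = raise W T′ (∁ C)

  pair : PairCover G W X₁ X₂
  pair = raise-pairCover G W T′ C cov cov∁

  size : ∣ X₁ ++ X₂ ∣ ≡ ∣ W ∣ + r
  size = begin
    ∣ X₁ ++ X₂ ∣          ≡⟨ ∣p++q∣ X₁ X₂ ⟩
    ∣ X₁ ∣ + ∣ X₂ ∣       ≡⟨ pairCover-size G W X₁ X₂ pair ⟩
    ∣ W ∣ + ∣ X₁ ∩ X₂ ∣   ≡⟨ cong (λ U → ∣ W ∣ + ∣ U ∣) (raise-∩ G W T′ C T′⊆W) ⟩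
    ∣ W ∣ + ∣ T′ ∣        ≡⟨ cong (∣ W ∣ +_) ∣T′∣≡r ⟩
    ∣ W ∣ + r             ∎
    where open ≡-Reasoning

  -- Every v ∈ T lies in W but not in T′.
  exactlyOne : ∀ v → v ∈ T → ExactlyOne ((v ↑ˡ n) ∈ X₁ ++ X₂) ((n ↑ʳ v) ∈ X₁ ++ X₂)
  exactlyOne v v∈T = ExactlyOne-map (⇔-sym (∈-++ˡ X₁)) (⇔-sym (∈-++ʳ X₁))
    (raise-exactlyOne G W T′ C (T⊆W v∈T) (λ v∈T′ → x∈p─q⇒x∉q W T (T′⊆W─T v∈T′) v∈T))

-- From a vertex cover X₁ ++ X₂, the transversal is the overlap X₁ ∩ X₂.
doubledCover⇒transversal : ∀ (G : Graph n) W T r →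
  DoubledCover G W T r → Transversal G W T r
doubledCover⇒transversal {n} G W T r (X , cover , ∣X∣≡∣W∣+r , exactlyOne)
  with X₁ , X₂ , refl ← Vec.splitAt n X =
  X₁ ∩ X₂ , ∩⊆W─T , pairCover⇒OCT G W X₁ X₂ pair , size
  where
  pair : PairCover G W X₁ X₂
  pair = doubledCover⇒pairCover G W X₁ X₂ cover

  -- Vertices of T have exactly one copy in X, so they are not in X₁ ∩ X₂.
  ∩⊆W─T : X₁ ∩ X₂ ⊆ W ─ T
  ∩⊆W─T v∈∩ = x∈p∧x∉q⇒x∈p─q (proj₁ (proj₁ pair) (p∩q⊆p X₁ X₂ v∈∩)) λ v∈T →
    ExactlyOne⇒¬both (ExactlyOne-map (∈-++ˡ X₁) (∈-++ʳ X₁) (exactlyOne _ v∈T))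
      (x∈p∩q⁻ X₁ X₂ v∈∩)

  size : ∣ X₁ ∩ X₂ ∣ ≡ r
  size = +-cancelˡ-≡ ∣ W ∣ _ _ (begin
    ∣ W ∣ + ∣ X₁ ∩ X₂ ∣   ≡⟨ pairCover-size G W X₁ X₂ pair ⟨
    ∣ X₁ ∣ + ∣ X₂ ∣       ≡⟨ ∣p++q∣ X₁ X₂ ⟨
    ∣ X₁ ++ X₂ ∣          ≡⟨ ∣X∣≡∣W∣+r ⟩
    ∣ W ∣ + r             ∎)
    where open ≡-Reasoning

-- The vertex set W = ∁ (S ─ T) of H contains T, so the correspondence applies.
mainTheorem1 : (n : ℕ) (G : Graph n) (S T : Subset n) →
    IsOCT G S → T ⊆ S → IsBipartiteOn G T →
    (r : ℕ) →
    (Σ (Subset n) λ T′ → T′ ⊆ (∁ (S ─ T) ─ T) × IsOCTOn G (∁ (S ─ T)) T′ × ∣ T′ ∣ ≡ r)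
    ⇔
    (Σ (Subset (n + n)) λ X →
      IsVertexCoverOn (Double G) (∁ (S ─ T) ++ ∁ (S ─ T)) X
      × ∣ X ∣ ≡ ∣ ∁ (S ─ T) ∣ + r
      × (∀ v → v ∈ T → ExactlyOne ((v ↑ˡ n) ∈ X) ((n ↑ʳ v) ∈ X)))
mainTheorem1 n G S T _ _ _ r = mk⇔
  (transversal⇒doubledCover G (∁ (S ─ T)) T r (q⊆∁[p─q] S T))
  (doubledCover⇒transversal G (∁ (S ─ T)) T r)
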